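{- Let $m\ge1$ and $\alpha\in\mathbb N$ with $1<2m<\alpha<\omega$. Then $G_{O^\alpha_m}\not\le_L G_{O^\omega_1}$; hence $G_{O^\omega_1}<_L G_{O^\alpha_m}$.
   Context: Notation: $ex$ is the (possibly undefined) result of applying the $e$-th partial recursive function to $x$; $\langle\cdot,\cdot\rangle$ a recursive pairing. For $A,C\subseteq\mathbb N$: $A\wedge C=\{\langle a,c\rangle\}$, $A\to C=\{e\mid\forall a\in A\ (ea\text{ defined and in }C)\}$. For a nonempty family ${\cal A}$ of subsets of $\mathbb N$, $G_{\cal A}(p)=\bigcup_{A\in{\cal A}}(A\to p)$. For $f,g:\mathcal P(\mathbb N)\to\mathcal P(\mathbb N)$: $f\le g$ means $\bigcap_p(f(p)\to g(p))\ne\emptyset$; $L(g)(p)=\bigcap_{q}\big(((p\to q)\wedge(g(q)\to q))\to q\big)$; $f\le_L g$ means $f\le L(g)$; $f<_Lg$ means $f\le_L g$ and not $g\le_L f$. Finite $\alpha$ is identified with $\{1,\ldots,\alpha\}$, $\omega$ with $\mathbb N$; $O^\alpha_m=\{X\subseteq\alpha\mid|\alpha\setminus X|=m\}$. -}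

module Defs where

open import Level using (Level; _⊔_) renaming (suc to lsuc; zero to lzero)
open import Data.Nat using (ℕ; zero; suc; _+_; _*_; _≤_; _<_)
open import Data.Fin using (Fin; toℕ)
open import Data.Fin.Subset using (Subset; ∁; ∣_∣) renaming (_∈_ to _∈ₛ_)
open import Data.Product using (Σ; _×_; _,_; ∃; proj₁)
open import Relation.Binary.PropositionalEquality using (_≡_; _≢_)
open import Relation.Nullary using (¬_)

tri : ℕ → ℕ
tri zero    = zero
tri (suc n) = suc n + tri n

⟨_,_⟩ : ℕ → ℕ → ℕ
⟨ a , b ⟩ = tri (a + b) + b

-- A standard Gödel numbering of the unary partial recursive functions
-- (generated from constants, successor, the two unpairing functions,
-- composition, pairing, primitive recursion and minimisation).
-- Every number e is a code: e = 8*q + r with r < 8 selects the clause.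
--   r=0 : constant q                    r=1 : successor
--   r=2 : ⟨a,b⟩ ↦ a                     r=3 : ⟨a,b⟩ ↦ b
--   r=4, q=⟨f,g⟩ : x ↦ g(f x)            r=5, q=⟨f,g⟩ : x ↦ ⟨f x , g x⟩
--   r=6, q=⟨f,g⟩ : h⟨a,0⟩ = f a,  h⟨a,n+1⟩ = g⟨a,⟨n,h⟨a,n⟩⟩⟩
--   r=7, q=f     : x ↦ μn. f⟨x,n⟩ = 0
-- Eval e x y  means  "e x is defined and equals y".

code : ℕ → ℕ → ℕ
code q r = 8 * q + r

data Eval : ℕ → ℕ → ℕ → Set
data PR (f g a : ℕ) : ℕ → ℕ → Set
data Mu (f x : ℕ) : ℕ → ℕ → Set

data Eval where
  ev-const : ∀ {q x} → Eval (code q 0) x q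
  ev-succ  : ∀ {q x} → Eval (code q 1) x (suc x)
  ev-fst   : ∀ {q a b} → Eval (code q 2) ⟨ a , b ⟩ a
  ev-snd   : ∀ {q a b} → Eval (code q 3) ⟨ a , b ⟩ b
  ev-comp  : ∀ {f g x y z} → Eval f x y → Eval g y z → Eval (code ⟨ f , g ⟩ 4) x z
  ev-pair  : ∀ {f g x y z} → Eval f x y → Eval g x z → Eval (code ⟨ f , g ⟩ 5) x ⟨ y , z ⟩
  ev-prec  : ∀ {f g a n y} → PR f g a n y → Eval (code ⟨ f , g ⟩ 6) ⟨ a , n ⟩ y
  ev-mu    : ∀ {f x n} → Mu f x 0 n → Eval (code f 7) x n

-- PR f g a n y : h⟨a,n⟩ = y for h the primitive recursion of f, g
data PR f g a where
  pr-zero : ∀ {y} → Eval f a y → PR f g a zero y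
  pr-suc  : ∀ {n y z} → PR f g a n y → Eval g ⟨ a , ⟨ n , y ⟩ ⟩ z → PR f g a (suc n) z

-- Mu f x k n : searching from k, the least n ≥ k with f⟨x,n⟩ = 0 is n
-- (all f⟨x,j⟩ for k ≤ j < n being defined and nonzero)
data Mu f x where
  mu-stop : ∀ {k} → Eval f ⟨ x , k ⟩ zero → Mu f x k k
  mu-next : ∀ {k m n} → Eval f ⟨ x , k ⟩ (suc m) → Mu f x (suc k) n → Mu f x k n

Pred : (ℓ : Level) → Set (lsuc ℓ)
Pred ℓ = ℕ → Set ℓ

_∧_ : ∀ {a c} → Pred a → Pred c → Pred (a ⊔ c)
(A ∧ C) n = Σ ℕ λ x → Σ ℕ λ y → (n ≡ ⟨ x , y ⟩) × A x × C y

_⇒_ : ∀ {a c} → Pred a → Pred c → Pred (a ⊔ c)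
(A ⇒ C) e = ∀ x → A x → Σ ℕ λ y → Eval e x y × C y

infixr 5 _⇒_
infixr 6 _∧_

record Family : Set₁ where
  field
    Index    : Set
    member   : Index → Pred lzero

G : Family → Pred lzero → Pred lzero
G 𝒜 p e = Σ (Family.Index 𝒜) λ i → (Family.member 𝒜 i ⇒ p) e

_≤ᵣ_ : ∀ {a b} → (Pred lzero → Pred a) → (Pred lzero → Pred b) → Set (lsuc lzero ⊔ a ⊔ b)
f ≤ᵣ g = Σ ℕ λ e → ∀ (p : Pred lzero) → (f p ⇒ g p) e

L : (Pred lzero → Pred lzero) → Pred lzero → Pred (lsuc lzero)
L g p e = ∀ (q : Pred lzero) → (((p ⇒ q) ∧ (g q ⇒ q)) ⇒ q) e

_≤L_ : (Pred lzero → Pred lzero) → (Pred lzero → Pred lzero) → Set₁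
f ≤L g = f ≤ᵣ L g

_<L_ : (Pred lzero → Pred lzero) → (Pred lzero → Pred lzero) → Set₁
f <L g = (f ≤L g) × ¬ (g ≤L f)

-- a subset X ⊆ {1,…,α}, coded by S : Subset α (i ↦ i+1), seen in ℕ
embed : ∀ {α} → Subset α → Pred lzero
embed {α} S n = Σ (Fin α) λ i → (suc (toℕ i) ≡ n) × (i ∈ₛ S)

Ofin : (α m : ℕ) → Family
Ofin α m = record
  { Index  = Σ (Subset α) λ S → ∣ ∁ S ∣ ≡ m
  ; member = λ i → embed (proj₁ i)
  }

-- O^ω_1 = { X ⊆ ℕ | |ℕ ∖ X| = 1 } = { ℕ ∖ {k} | k ∈ ℕ }
Oω1 : Family
Oω1 = record
  { Index  = ℕ
  ; member = λ k n → n ≢ k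
  }

module Submission where

-- For the non-reduction, choose for each i ≤ α a set Sᵢ ∈ O^α_m with i ∉ Sᵢ, and let pᵢ be the
-- image of Sᵢ under the successor, so that the successor code lies in every G_{O^α_m}(pᵢ). As
-- evaluation is deterministic, a reduction sends it to a single r lying in every L(G_{O^ω_1})(pᵢ).
-- Taking for q the inductive closure Tree pᵢ of pᵢ under G_{O^ω_1}(q) → q, the value of r at
-- ⟨leaf,node⟩ lies in every Tree pᵢ. But these trees have no common element: the pᵢ are disjoint,
-- and a node common to all of them has a child common to all of them, found by probing it at a
-- point avoiding the finitely many excluded points.
--
-- For the reduction, if r realizes (ℕ∖{k}) → p and a realizes p → q, then a∘r realizes X → q for
-- any X ∈ O^α_m with k ∉ X, so b(a∘r) ∈ q whenever b realizes G_{O^α_m}(q) → q. The code of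
-- ⟨a,b⟩ ↦ b(a∘r) is computable from r, given a universal function; the latter is obtained by
-- iterating one step of a stack machine by primitive recursion and searching for the halting time.

open import Defs
open import Level using (0ℓ)
open import Data.Bool.Base using (T)
open import Data.Empty using (⊥-elim)
open import Data.Fin using (Fin; toℕ; fromℕ<) renaming (zero to fzero; suc to fsuc)
open import Data.Fin.Subset using (Subset; ∁; ∣_∣; inside; outside; ⊥) renaming (_∈_ to _∈ₛ_)
open import Data.Fin.Subset.Properties using (∉⊥; ∣⊥∣≡0; ∣∁p∣≡n∸∣p∣)
open import Data.List using (List; []; _∷_)
open import Data.List.NonEmpty using (List⁺; _∷_)
open import Data.Nat
  using (ℕ; zero; suc; pred; _+_; _*_; _∸_; _⊔_; _≤_; _<_; _<ᵇ_; z≤n; s≤s; _≟_; _≤?_)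
open import Data.Nat.DivMod using (_%_; %-congˡ; [m+kn]%n≡m%n; m<n⇒m%n≡m)
open import Data.Nat.Properties
open import Data.Nat.Tactic.RingSolver using (solve-∀)
open import Data.Product using (Σ; _×_; _,_; proj₁; proj₂)
open import Data.Unit using (⊤)
open import Data.Vec using ([]; _∷_; here; there)
open import Data.Vec.Functional using (Vector) renaming (_∷_ to _∷ᵛ_)
open import Function using (_∘_)
open import Relation.Binary.Definitions using (tri<; tri≈; tri>)
open import Relation.Binary.PropositionalEquality
open import Relation.Nullary using (¬_; yes; no)

tri-mono-≤ : ∀ {s t} → s ≤ t → tri s ≤ tri t
tri-mono-≤ {zero}  _          = z≤n
tri-mono-≤ {suc s} (s≤s s≤t) = +-mono-≤ (s≤s s≤t) (tri-mono-≤ s≤t)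

⟨,⟩-mono-< : ∀ {a b a′ b′} → a + b < a′ + b′ → ⟨ a , b ⟩ < ⟨ a′ , b′ ⟩
⟨,⟩-mono-< {a} {b} {a′} {b′} lt = begin-strict
  tri (a + b) + b            <⟨ +-monoʳ-< (tri (a + b)) (s≤s (m≤n+m b a)) ⟩
  tri (a + b) + suc (a + b)  ≡⟨ +-comm (tri (a + b)) _ ⟩
  tri (suc (a + b))          ≤⟨ tri-mono-≤ lt ⟩
  tri (a′ + b′)              ≤⟨ m≤m+n _ b′ ⟩
  ⟨ a′ , b′ ⟩                ∎
  where open ≤-Reasoning

⟨,⟩-injective : ∀ {a b a′ b′} → ⟨ a , b ⟩ ≡ ⟨ a′ , b′ ⟩ → a ≡ a′ × b ≡ b′
⟨,⟩-injective {a} {b} {a′} {b′} eq with <-cmp (a + b) (a′ + b′)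
... | tri< lt _ _ = ⊥-elim (<-irrefl eq (⟨,⟩-mono-< {a} {b} {a′} {b′} lt))
... | tri> _ _ gt = ⊥-elim (<-irrefl (sym eq) (⟨,⟩-mono-< {a′} {b′} {a} {b} gt))
... | tri≈ _ s≡s′ _ = a≡a′ , b≡b′
  where
  b≡b′ : b ≡ b′
  b≡b′ = +-cancelˡ-≡ (tri (a + b)) b b′ (trans eq (cong (λ s → tri s + b′) (sym s≡s′)))
  a≡a′ : a ≡ a′
  a≡a′ = +-cancelʳ-≡ b a a′ (trans s≡s′ (cong (a′ +_) (sym b≡b′)))

⟨,⟩-surjective : ∀ n → Σ ℕ λ a → Σ ℕ λ b → n ≡ ⟨ a , b ⟩
⟨,⟩-surjective zero = 0 , 0 , refl
⟨,⟩-surjective (suc n) with ⟨,⟩-surjective n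
... | zero , b , refl = suc b , 0 ,
  trans (cong suc (+-comm (tri b) b))
        (sym (trans (+-identityʳ _) (cong (tri ∘ suc) (+-identityʳ b))))
... | suc a , b , refl = a , suc b ,
  sym (trans (cong (λ s → tri s + suc b) (+-suc a b)) (+-suc _ b))

code-remainder : ∀ q {r} → r < 8 → code q r % 8 ≡ r
code-remainder q {r} r<8 = begin
  (8 * q + r) % 8  ≡⟨ %-congˡ (trans (+-comm (8 * q) r) (cong (r +_) (*-comm 8 q))) ⟩
  (r + q * 8) % 8  ≡⟨ [m+kn]%n≡m%n r q 8 ⟩
  r % 8            ≡⟨ m<n⇒m%n≡m r<8 ⟩
  r                ∎
  where open ≡-Reasoning

-- Remainder bounds are boolean so that they are discharged automatically for literals.
code-injective : ∀ {q r q′ r′} {_ : T (r <ᵇ 8)} {_ : T (r′ <ᵇ 8)} →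
                 code q r ≡ code q′ r′ → q ≡ q′ × r ≡ r′
code-injective {q} {r} {q′} {r′} {r<8} {r′<8} eq
  with trans (sym (code-remainder q (<ᵇ⇒< r 8 r<8)))
             (trans (cong (_% 8) eq) (code-remainder q′ (<ᵇ⇒< r′ 8 r′<8)))
... | refl = *-cancelˡ-≡ q q′ 8 (+-cancelʳ-≡ r _ _ eq) , refl

Clause : ℕ → ℕ → ℕ → ℕ → Set
Clause 0 q x y = y ≡ q
Clause 1 q x y = y ≡ suc x
Clause 2 q x y = Σ ℕ λ a → Σ ℕ λ b → x ≡ ⟨ a , b ⟩ × y ≡ a
Clause 3 q x y = Σ ℕ λ a → Σ ℕ λ b → x ≡ ⟨ a , b ⟩ × y ≡ b
Clause 4 q x y = Σ ℕ λ f → Σ ℕ λ g → q ≡ ⟨ f , g ⟩ ×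
                 Σ ℕ λ z → Eval f x z × Eval g z y
Clause 5 q x y = Σ ℕ λ f → Σ ℕ λ g → q ≡ ⟨ f , g ⟩ ×
                 Σ ℕ λ z₁ → Σ ℕ λ z₂ → Eval f x z₁ × Eval g x z₂ × y ≡ ⟨ z₁ , z₂ ⟩
Clause 6 q x y = Σ ℕ λ f → Σ ℕ λ g → Σ ℕ λ a → Σ ℕ λ n →
                 q ≡ ⟨ f , g ⟩ × x ≡ ⟨ a , n ⟩ × PR f g a n y
Clause 7 q x y = Mu q x 0 y
Clause _ q x y = ⊤

Eval-inversion : ∀ {e x y q r} {_ : T (r <ᵇ 8)} → Eval e x y → e ≡ code q r → Clause r q x y
Eval-inversion {q = q} {r} {r<8} (ev-const {q′}) eq
  with code-injective {q′} {0} {q} {r} {_} {r<8} eq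
... | refl , refl = refl
Eval-inversion {q = q} {r} {r<8} (ev-succ {q′}) eq
  with code-injective {q′} {1} {q} {r} {_} {r<8} eq
... | refl , refl = refl
Eval-inversion {q = q} {r} {r<8} (ev-fst {q′} {a} {b}) eq
  with code-injective {q′} {2} {q} {r} {_} {r<8} eq
... | refl , refl = a , b , refl , refl
Eval-inversion {q = q} {r} {r<8} (ev-snd {q′} {a} {b}) eq
  with code-injective {q′} {3} {q} {r} {_} {r<8} eq
... | refl , refl = a , b , refl , refl
Eval-inversion {q = q} {r} {r<8} (ev-comp {f} {g} d₁ d₂) eq
  with code-injective {⟨ f , g ⟩} {4} {q} {r} {_} {r<8} eq
... | refl , refl = f , g , refl , _ , d₁ , d₂
Eval-inversion {q = q} {r} {r<8} (ev-pair {f} {g} d₁ d₂) eq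
  with code-injective {⟨ f , g ⟩} {5} {q} {r} {_} {r<8} eq
... | refl , refl = f , g , refl , _ , _ , d₁ , d₂ , refl
Eval-inversion {q = q} {r} {r<8} (ev-prec {f} {g} {a} {n} p) eq
  with code-injective {⟨ f , g ⟩} {6} {q} {r} {_} {r<8} eq
... | refl , refl = f , g , a , n , refl , refl , p
Eval-inversion {q = q} {r} {r<8} (ev-mu {f} μ) eq
  with code-injective {f} {7} {q} {r} {_} {r<8} eq
... | refl , refl = μ

Eval-deterministic : ∀ {e x y y′} → Eval e x y → Eval e x y′ → y ≡ y′
PR-deterministic : ∀ {f g a n y y′} → PR f g a n y → PR f g a n y′ → y ≡ y′
Mu-deterministic : ∀ {f x k n n′} → Mu f x k n → Mu f x k n′ → n ≡ n′

Eval-deterministic (ev-const {q}) d = sym (Eval-inversion {q = q} d refl)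
Eval-deterministic (ev-succ {q}) d = sym (Eval-inversion {q = q} d refl)
Eval-deterministic (ev-fst {q} {a} {b}) d with Eval-inversion {q = q} d refl
... | a′ , b′ , eq , refl = proj₁ (⟨,⟩-injective {a} {b} {a′} {b′} eq)
Eval-deterministic (ev-snd {q} {a} {b}) d with Eval-inversion {q = q} d refl
... | a′ , b′ , eq , refl = proj₂ (⟨,⟩-injective {a} {b} {a′} {b′} eq)
Eval-deterministic (ev-comp {f} {g} d₁ d₂) d with Eval-inversion {q = ⟨ f , g ⟩} d refl
... | f′ , g′ , eq , _ , d₁′ , d₂′ with ⟨,⟩-injective {f} {g} {f′} {g′} eq
... | refl , refl with Eval-deterministic d₁ d₁′
... | refl = Eval-deterministic d₂ d₂′
Eval-deterministic (ev-pair {f} {g} d₁ d₂) d with Eval-inversion {q = ⟨ f , g ⟩} d refl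
... | f′ , g′ , eq , _ , _ , d₁′ , d₂′ , refl with ⟨,⟩-injective {f} {g} {f′} {g′} eq
... | refl , refl = cong₂ ⟨_,_⟩ (Eval-deterministic d₁ d₁′) (Eval-deterministic d₂ d₂′)
Eval-deterministic (ev-prec {f} {g} {a} {n} p) d with Eval-inversion {q = ⟨ f , g ⟩} d refl
... | f′ , g′ , a′ , n′ , eq₁ , eq₂ , p′
  with ⟨,⟩-injective {f} {g} {f′} {g′} eq₁ | ⟨,⟩-injective {a} {n} {a′} {n′} eq₂
... | refl , refl | refl , refl = PR-deterministic p p′
Eval-deterministic (ev-mu {f} μ) d = Mu-deterministic μ (Eval-inversion {q = f} d refl)

PR-deterministic (pr-zero d) (pr-zero d′) = Eval-deterministic d d′
PR-deterministic (pr-suc p d) (pr-suc p′ d′) with PR-deterministic p p′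
... | refl = Eval-deterministic d d′

Mu-deterministic (mu-stop _) (mu-stop _) = refl
Mu-deterministic (mu-stop d) (mu-next d′ _) with Eval-deterministic d d′
... | ()
Mu-deterministic (mu-next d _) (mu-stop d′) with Eval-deterministic d d′
... | ()
Mu-deterministic (mu-next _ μ) (mu-next _ μ′) = Mu-deterministic μ μ′

subset-of-co-size : ∀ {α m} → m ≤ α → Σ (Subset α) λ S → ∣ ∁ S ∣ ≡ m
subset-of-co-size {zero} z≤n = [] , refl
subset-of-co-size {suc α} {zero} _ with subset-of-co-size {α} z≤n
... | S , c = inside ∷ S , c
subset-of-co-size {suc α} {suc m} (s≤s m≤α) with subset-of-co-size m≤α
... | S , c = outside ∷ S , cong suc c

subset-of-co-size-avoiding : ∀ {α m} t → 1 ≤ m → m ≤ α →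
  Σ (Subset α) λ S → ∣ ∁ S ∣ ≡ m × (∀ {i} → i ∈ₛ S → toℕ i ≢ t)
subset-of-co-size-avoiding {zero} _ (s≤s z≤n) ()
subset-of-co-size-avoiding {suc α} {suc m} zero _ (s≤s m≤α) with subset-of-co-size m≤α
... | S , c = outside ∷ S , cong suc c , λ { (there _) () }
subset-of-co-size-avoiding {suc α} {m} (suc t) 1≤m m≤1+α with m ≤? α
... | yes m≤α with subset-of-co-size-avoiding t 1≤m m≤α
...   | S , c , avoid = inside ∷ S , c , λ { here () ; (there i∈S) → avoid i∈S ∘ suc-injective }
subset-of-co-size-avoiding {suc α} {m} (suc t) 1≤m m≤1+α | no m≰α =
  ∅ , c , λ i∈∅ → ⊥-elim (∉⊥ i∈∅)
  where
  ∅ : Subset (suc α)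
  ∅ = ⊥
  c : ∣ ∁ ∅ ∣ ≡ m
  c = begin
    ∣ ∁ ∅ ∣            ≡⟨ ∣∁p∣≡n∸∣p∣ ∅ ⟩
    suc α ∸ ∣ ∅ ∣      ≡⟨ cong (suc α ∸_) (∣⊥∣≡0 (suc α)) ⟩
    suc α              ≡⟨ ≤-antisym (≰⇒> m≰α) m≤1+α ⟩
    m                  ∎
    where open ≡-Reasoning

subset-of-co-size-missing : ∀ {α m} k → 1 ≤ m → m ≤ α →
  Σ (Subset α) λ S → ∣ ∁ S ∣ ≡ m × ¬ embed S k
subset-of-co-size-missing k 1≤m m≤α with subset-of-co-size-avoiding (pred k) 1≤m m≤α
... | S , c , avoid = S , c , λ (i , 1+i≡k , i∈S) → avoid i∈S (cong pred 1+i≡k)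

strict-upper-bound : ∀ {n} (ks : Vector ℕ n) → Σ ℕ λ b → ∀ i → ks i < b
strict-upper-bound {zero} ks = 0 , λ ()
strict-upper-bound {suc n} ks with strict-upper-bound (ks ∘ fsuc)
... | b , bounds = suc (ks fzero) ⊔ b , λ where
  fzero    → m≤m⊔n (suc (ks fzero)) b
  (fsuc i) → <-≤-trans (bounds i) (m≤n⊔m (suc (ks fzero)) b)

image-suc : Pred 0ℓ → Pred 0ℓ
image-suc A n = Σ ℕ λ x → n ≡ suc x × A x

data Tree (p : Pred 0ℓ) : Pred 0ℓ where
  leaf : ∀ {x} → p x → Tree p ⟨ 0 , suc x ⟩
  node : ∀ {d} → G Oω1 (Tree p) d → Tree p ⟨ 1 , suc d ⟩

Tree-leaf⁻¹ : ∀ {p x y} → Tree p y → y ≡ ⟨ 0 , suc x ⟩ → p x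
Tree-leaf⁻¹ {x = x} (leaf {x′} px) eq with ⟨,⟩-injective {0} {suc x′} {0} {suc x} eq
... | _ , refl = px
Tree-leaf⁻¹ {x = x} (node {d} _) eq with ⟨,⟩-injective {1} {suc d} {0} {suc x} eq
... | () , _

Tree-node⁻¹ : ∀ {p d y} → Tree p y → y ≡ ⟨ 1 , suc d ⟩ → G Oω1 (Tree p) d
Tree-node⁻¹ {d = d} (leaf {x} _) eq with ⟨,⟩-injective {0} {suc x} {1} {suc d} eq
... | () , _
Tree-node⁻¹ {d = d} (node {d′} g) eq with ⟨,⟩-injective {1} {suc d′} {1} {suc d} eq
... | _ , refl = g

-- x ↦ ⟨0, x+1⟩ and x ↦ ⟨1, x+1⟩: the successor passes its argument on without unpairing it.
leaf-code node-code : ℕ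
leaf-code = code ⟨ code 0 0 , code 0 1 ⟩ 5
node-code = code ⟨ code 1 0 , code 0 1 ⟩ 5

Tree-closure : ∀ p → ((p ⇒ Tree p) ∧ (G Oω1 (Tree p) ⇒ Tree p)) ⟨ leaf-code , node-code ⟩
Tree-closure p = leaf-code , node-code , refl , to-leaf , to-node
  where
  to-leaf : (p ⇒ Tree p) leaf-code
  to-leaf x px = _ , ev-pair {code 0 0} {code 0 1} (ev-const {0}) (ev-succ {0}) , leaf px
  to-node : (G Oω1 (Tree p) ⇒ Tree p) node-code
  to-node d g = _ , ev-pair {code 1 0} {code 0 1} (ev-const {1}) (ev-succ {0}) , node g

L-Oω1⇒Tree : ∀ {p r} → L (G Oω1) p r →
             Σ ℕ λ y → Eval r ⟨ leaf-code , node-code ⟩ y × Tree p y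
L-Oω1⇒Tree {p} l = l (Tree p) _ (Tree-closure p)

module _ {n} (p : Vector (Pred 0ℓ) n) (disjoint : ∀ x → ¬ (∀ i → p i x)) where

  Trees-disjoint : ∀ {i₀ y} → Tree (p i₀) y → ¬ (∀ i → Tree (p i) y)
  Trees-disjoint (leaf {x} _) ts = disjoint x λ i → Tree-leaf⁻¹ (ts i) refl
  Trees-disjoint (node {d} (k₀ , f₀)) ts =
    Trees-disjoint (proj₂ (proj₂ (f₀ x x≢k₀))) ts′
    where
    children : ∀ i → G Oω1 (Tree (p i)) d
    children i = Tree-node⁻¹ (ts i) refl
    fresh : Σ ℕ λ b → ∀ i → (k₀ ∷ᵛ (proj₁ ∘ children)) i < b
    fresh = strict-upper-bound (k₀ ∷ᵛ (proj₁ ∘ children))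
    x : ℕ
    x = proj₁ fresh
    x≢k₀ : x ≢ k₀
    x≢k₀ = >⇒≢ (proj₂ fresh fzero)
    ts′ : ∀ i → Tree (p i) (proj₁ (f₀ x x≢k₀))
    ts′ i with proj₂ (children i) x (>⇒≢ (proj₂ fresh (fsuc i)))
    ... | _ , evᵢ , tᵢ =
      subst (Tree (p i)) (Eval-deterministic evᵢ (proj₁ (proj₂ (f₀ x x≢k₀)))) tᵢ

no-common-L-realizer : ∀ {n} (p : Vector (Pred 0ℓ) n) → Fin n → (∀ x → ¬ (∀ i → p i x)) →
                       ∀ r → ¬ (∀ i → L (G Oω1) (p i) r)
no-common-L-realizer p i₀ disjoint r ls =
  Trees-disjoint p disjoint (tree i₀) λ i →
    subst (Tree (p i)) (Eval-deterministic (proj₁ (proj₂ (L-Oω1⇒Tree (ls i))))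
                                           (proj₁ (proj₂ (L-Oω1⇒Tree (ls i₀)))))
          (tree i)
  where
  tree : ∀ i → Tree (p i) (proj₁ (L-Oω1⇒Tree (ls i)))
  tree i = proj₂ (proj₂ (L-Oω1⇒Tree (ls i)))

G-Ofin-≰L-G-Oω1 : ∀ {α m} → 1 ≤ m → m ≤ α → ¬ (G (Ofin α m) ≤L G Oω1)
G-Ofin-≰L-G-Oω1 {α} {m} 1≤m m≤α (e , reduce) = no-common-L-realizer p i₀ disjoint r Ls
  where
  missing : (i : Fin α) → Σ (Subset α) λ S → ∣ ∁ S ∣ ≡ m × ¬ embed S (suc (toℕ i))
  missing i = subset-of-co-size-missing (suc (toℕ i)) 1≤m m≤α
  S : Fin α → Subset α
  S = proj₁ ∘ missing
  p : Vector (Pred 0ℓ) α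
  p i = image-suc (embed (S i))
  i₀ : Fin α
  i₀ = fromℕ< (≤-trans 1≤m m≤α)
  disjoint : ∀ x → ¬ (∀ i → p i x)
  disjoint x ps with ps i₀
  ... | x′ , refl , j , 1+j≡x′ , _ with ps j
  ...   | _ , refl , x′∈Sⱼ = proj₂ (proj₂ (missing j)) (subst (embed (S j)) (sym 1+j≡x′) x′∈Sⱼ)
  succ∈G : ∀ i → G (Ofin α m) (p i) (code 0 1)
  succ∈G i = (S i , proj₁ (proj₂ (missing i))) , λ x x∈Sᵢ → suc x , ev-succ {0} , x , refl , x∈Sᵢ
  reduced : ∀ i → Σ ℕ λ r → Eval e (code 0 1) r × L (G Oω1) (p i) r
  reduced i = reduce (p i) (code 0 1) (succ∈G i)
  r : ℕ
  r = proj₁ (reduced i₀)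
  Ls : ∀ i → L (G Oω1) (p i) r
  Ls i = subst (L (G Oω1) (p i))
               (Eval-deterministic (proj₁ (proj₂ (reduced i))) (proj₁ (proj₂ (reduced i₀))))
               (proj₂ (proj₂ (reduced i)))

-- Opaque copies of pairing and coding, so that unification treats them as rigid instead of
-- unfolding the underlying arithmetic.
opaque
  pair : ℕ → ℕ → ℕ
  pair a b = ⟨ a , b ⟩

  code′ : ℕ → ℕ → ℕ
  code′ = code

opaque
  unfolding pair code′

  pair-unfold : ∀ a b → pair a b ≡ ⟨ a , b ⟩
  pair-unfold a b = refl

  code′-unfold : ∀ q r → code′ q r ≡ code q r
  code′-unfold q r = refl

pair-surjective : ∀ n → Σ ℕ λ a → Σ ℕ λ b → n ≡ pair a b
pair-surjective n with ⟨,⟩-surjective n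
... | a , b , eq = a , b , trans eq (sym (pair-unfold a b))

infixr 7 _⨾_
data Tm : Set where
  K           : ℕ → Tm
  S P₁ P₂     : Tm
  _⨾_ ⟪_,_⟫ R : Tm → Tm → Tm

compile : Tm → ℕ
compile (K n)     = code′ n 0
compile S         = code′ 0 1
compile P₁        = code′ 0 2
compile P₂        = code′ 0 3
compile (f ⨾ g)   = code′ ⟨ compile f , compile g ⟩ 4
compile ⟪ f , g ⟫ = code′ ⟨ compile f , compile g ⟩ 5
compile (R f g)   = code′ ⟨ compile f , compile g ⟩ 6

-- A record rather than a synonym for Eval (compile t), so that t stays visible to unification.
infix 4 _∙_⇓_
record _∙_⇓_ (t : Tm) (x y : ℕ) : Set where
  constructor mk
  field run : Eval (compile t) x y
open _∙_⇓_ public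

_⇓≡_ : ∀ {t x y y′} → t ∙ x ⇓ y → y ≡ y′ → t ∙ x ⇓ y′
d ⇓≡ refl = d

⇓-of-Eval : ∀ {t q r x y} → compile t ≡ code′ q r → Eval (code q r) x y → t ∙ x ⇓ y
⇓-of-Eval {q = q} {r} {x} {y} eq d =
  mk (subst (λ e → Eval e x y) (sym (trans eq (code′-unfold q r))) d)

⇓K : ∀ {n x} → K n ∙ x ⇓ n
⇓K {n} = ⇓-of-Eval refl (ev-const {n})

⇓S : ∀ {x} → S ∙ x ⇓ suc x
⇓S = ⇓-of-Eval refl (ev-succ {0})

⇓P₁ : ∀ {a b} → P₁ ∙ pair a b ⇓ a
⇓P₁ {a} {b} = subst (λ v → P₁ ∙ v ⇓ a) (sym (pair-unfold a b)) (⇓-of-Eval refl (ev-fst {0} {a} {b}))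

⇓P₂ : ∀ {a b} → P₂ ∙ pair a b ⇓ b
⇓P₂ {a} {b} = subst (λ v → P₂ ∙ v ⇓ b) (sym (pair-unfold a b)) (⇓-of-Eval refl (ev-snd {0} {a} {b}))

infixr 7 _⇓⨾_
_⇓⨾_ : ∀ {f g x y z} → f ∙ x ⇓ y → g ∙ y ⇓ z → (f ⨾ g) ∙ x ⇓ z
_⇓⨾_ {f} {g} (mk d₁) (mk d₂) = ⇓-of-Eval refl (ev-comp {compile f} {compile g} d₁ d₂)

⇓⟪_,_⟫ : ∀ {f g x y z} → f ∙ x ⇓ y → g ∙ x ⇓ z → ⟪ f , g ⟫ ∙ x ⇓ pair y z
⇓⟪_,_⟫ {f} {g} {x} {y} {z} (mk d₁) (mk d₂) =
  ⇓-of-Eval refl (ev-pair {compile f} {compile g} d₁ d₂) ⇓≡ sym (pair-unfold y z)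

data Rec (f g : Tm) (a : ℕ) : ℕ → ℕ → Set where
  rec-zero : ∀ {y} → f ∙ a ⇓ y → Rec f g a 0 y
  rec-suc  : ∀ {n y w} → Rec f g a n y → g ∙ pair a (pair n y) ⇓ w → Rec f g a (suc n) w

Rec⇒PR : ∀ {f g a n y} → Rec f g a n y → PR (compile f) (compile g) a n y
Rec⇒PR (rec-zero (mk d)) = pr-zero d
Rec⇒PR {f} {g} {a} (rec-suc {n} {y} {w} p (mk d)) =
  pr-suc (Rec⇒PR p) (subst (λ v → Eval (compile g) v w) unfold d)
  where
  unfold : pair a (pair n y) ≡ ⟨ a , ⟨ n , y ⟩ ⟩
  unfold = trans (pair-unfold a (pair n y)) (cong ⟨ a ,_⟩ (pair-unfold n y))

⇓R : ∀ {f g a n y} → Rec f g a n y → R f g ∙ pair a n ⇓ y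
⇓R {f} {g} {a} {n} {y} p =
  subst (λ v → R f g ∙ v ⇓ y) (sym (pair-unfold a n))
        (⇓-of-Eval refl (ev-prec {compile f} {compile g} (Rec⇒PR p)))

ID : Tm
ID = ⟪ P₁ , P₂ ⟫

⇓ID : ∀ {x} → ID ∙ x ⇓ x
⇓ID {x} with pair-surjective x
... | a , b , refl = ⇓⟪ ⇓P₁ , ⇓P₂ ⟫

⇓-total : ∀ t x → Σ ℕ λ y → t ∙ x ⇓ y
Rec-total : ∀ f g a n → Σ ℕ λ y → Rec f g a n y

⇓-total (K n) x = n , ⇓K
⇓-total S x = suc x , ⇓S
⇓-total P₁ x with pair-surjective x
... | a , b , refl = a , ⇓P₁
⇓-total P₂ x with pair-surjective x
... | a , b , refl = b , ⇓P₂
⇓-total (f ⨾ g) x with ⇓-total f x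
... | y , d₁ with ⇓-total g y
... | z , d₂ = z , (d₁ ⇓⨾ d₂)
⇓-total ⟪ f , g ⟫ x with ⇓-total f x | ⇓-total g x
... | y , d₁ | z , d₂ = pair y z , ⇓⟪ d₁ , d₂ ⟫
⇓-total (R f g) x with pair-surjective x
... | a , n , refl with Rec-total f g a n
... | y , p = y , ⇓R p

Rec-total f g a zero with ⇓-total f a
... | y , d = y , rec-zero d
Rec-total f g a (suc n) with Rec-total f g a n
... | y , p with ⇓-total g (pair a (pair n y))
... | w , d = w , rec-suc p d

PRED : Tm
PRED = ⟪ ID , ID ⟫ ⨾ R (K 0) (P₂ ⨾ P₁)

⇓PRED : ∀ {n} → PRED ∙ n ⇓ pred n
⇓PRED {zero} = ⇓⟪ ⇓ID , ⇓ID ⟫ ⇓⨾ ⇓R (rec-zero ⇓K)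
⇓PRED {suc n} = ⇓⟪ ⇓ID , ⇓ID ⟫ ⇓⨾ ⇓R (rec-suc (proj₂ (Rec-total (K 0) (P₂ ⨾ P₁) _ n)) (⇓P₂ ⇓⨾ ⇓P₁))

SUB : Tm
SUB = R ID (P₂ ⨾ P₂ ⨾ PRED)

⇓SUB : ∀ {a n} → SUB ∙ pair a n ⇓ a ∸ n
⇓SUB {a} {n} = ⇓R (trace n)
  where
  trace : ∀ n → Rec ID (P₂ ⨾ P₂ ⨾ PRED) a n (a ∸ n)
  trace zero    = rec-zero ⇓ID
  trace (suc n) = subst (Rec ID (P₂ ⨾ P₂ ⨾ PRED) a (suc n)) (pred[m∸n]≡m∸[1+n] a n)
                        (rec-suc (trace n) (⇓P₂ ⇓⨾ ⇓P₂ ⇓⨾ ⇓PRED))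

ADD : Tm
ADD = R ID (P₂ ⨾ P₂ ⨾ S)

⇓ADD : ∀ {a n} → ADD ∙ pair a n ⇓ a + n
⇓ADD {a} {n} = ⇓R (trace n)
  where
  trace : ∀ n → Rec ID (P₂ ⨾ P₂ ⨾ S) a n (a + n)
  trace zero    = subst (Rec ID (P₂ ⨾ P₂ ⨾ S) a 0) (sym (+-identityʳ a)) (rec-zero ⇓ID)
  trace (suc n) = subst (Rec ID (P₂ ⨾ P₂ ⨾ S) a (suc n)) (sym (+-suc a n))
                        (rec-suc (trace n) (⇓P₂ ⇓⨾ ⇓P₂ ⇓⨾ ⇓S))

m<n⇒n∸m≡1+[n∸1+m] : ∀ {m n} → m < n → n ∸ m ≡ suc (n ∸ suc m)
m<n⇒n∸m≡1+[n∸1+m] {zero}  {suc n} _         = refl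
m<n⇒n∸m≡1+[n∸1+m] {suc m} {suc n} (s≤s m<n) = m<n⇒n∸m≡1+[n∸1+m] m<n

IFZ : Tm → Tm → Tm → Tm
IFZ c A B = ⟪ ID , c ⟫ ⨾ R A (P₁ ⨾ B)

⇓IFZ-zero : ∀ {c A B x y} → c ∙ x ⇓ 0 → A ∙ x ⇓ y → IFZ c A B ∙ x ⇓ y
⇓IFZ-zero dc dA = ⇓⟪ ⇓ID , dc ⟫ ⇓⨾ ⇓R (rec-zero dA)

⇓IFZ-suc : ∀ {c A B x y k} → c ∙ x ⇓ suc k → B ∙ x ⇓ y → IFZ c A B ∙ x ⇓ y
⇓IFZ-suc {c} {A} {B} {x} {y} {k} dc dB = ⇓⟪ ⇓ID , dc ⟫ ⇓⨾ ⇓R (trace k)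
  where
  trace : ∀ k → Rec A (P₁ ⨾ B) x (suc k) y
  trace zero    = rec-suc (rec-zero (proj₂ (⇓-total A x))) (⇓P₁ ⇓⨾ dB)
  trace (suc k) = rec-suc (trace k) (⇓P₁ ⇓⨾ dB)

-- The last case doubles as the default.
select-from : Tm → List Tm → ℕ → Tm
select-from c []        _       = c
select-from c (c′ ∷ cs) zero    = c
select-from c (c′ ∷ cs) (suc k) = select-from c′ cs k

switch-from : ℕ → Tm → Tm → List Tm → Tm
switch-from j sel c []        = c
switch-from j sel c (c′ ∷ cs) = IFZ (⟪ sel , K j ⟫ ⨾ SUB) c (switch-from (suc j) sel c′ cs)

⇓switch-from : ∀ {sel x r y} j c cs → sel ∙ x ⇓ r → j ≤ r →
               select-from c cs (r ∸ j) ∙ x ⇓ y → switch-from j sel c cs ∙ x ⇓ y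
⇓switch-from j c [] _ _ d = d
⇓switch-from {sel} {x} {r} {y} j c (c′ ∷ cs) ds j≤r d with r ≟ j
... | yes refl = ⇓IFZ-zero ((⇓⟪ ds , ⇓K ⟫ ⇓⨾ ⇓SUB) ⇓≡ n∸n≡0 r)
                           (subst (λ v → select-from c (c′ ∷ cs) v ∙ x ⇓ y) (n∸n≡0 r) d)
... | no r≢j = ⇓IFZ-suc ((⇓⟪ ds , ⇓K ⟫ ⇓⨾ ⇓SUB) ⇓≡ r∸j≡1+)
                        (⇓switch-from (suc j) c′ cs ds j<r
                           (subst (λ v → select-from c (c′ ∷ cs) v ∙ x ⇓ y) r∸j≡1+ d))
  where
  j<r : j < r
  j<r = ≤∧≢⇒< j≤r (≢-sym r≢j)
  r∸j≡1+ : r ∸ j ≡ suc (r ∸ suc j)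
  r∸j≡1+ = m<n⇒n∸m≡1+[n∸1+m] j<r

select : List⁺ Tm → ℕ → Tm
select (c ∷ cs) = select-from c cs

switch : Tm → List⁺ Tm → Tm
switch sel (c ∷ cs) = switch-from 0 sel c cs

⇓switch : ∀ {sel x r y} cs → sel ∙ x ⇓ r → select cs r ∙ x ⇓ y → switch sel cs ∙ x ⇓ y
⇓switch (c ∷ cs) ds d = ⇓switch-from 0 c cs ds z≤n d

-- ⟨q,r⟩ ↦ ⟨q,r+1⟩, carrying into q at r = 7
INC8 : Tm
INC8 = IFZ (⟪ K 7 , P₂ ⟫ ⨾ SUB) ⟪ P₁ ⨾ S , K 0 ⟫ ⟪ P₁ , P₂ ⨾ S ⟫

DIVMOD8 : Tm
DIVMOD8 = ⟪ K 0 , ID ⟫ ⨾ R (K (pair 0 0)) (P₂ ⨾ P₂ ⨾ INC8)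

divmod8-trace : ∀ n → Σ ℕ λ q → Σ ℕ λ r → r < 8 × n ≡ code q r ×
                Rec (K (pair 0 0)) (P₂ ⨾ P₂ ⨾ INC8) 0 n (pair q r)
divmod8-trace zero = 0 , 0 , s≤s z≤n , refl , rec-zero ⇓K
divmod8-trace (suc n) with divmod8-trace n
... | q , r , r<8 , refl , p with r ≟ 7
... | yes refl = suc q , 0 , s≤s z≤n , carry q ,
      rec-suc p (⇓P₂ ⇓⨾ ⇓P₂ ⇓⨾ ⇓IFZ-zero (⇓⟪ ⇓K , ⇓P₂ ⟫ ⇓⨾ ⇓SUB) ⇓⟪ ⇓P₁ ⇓⨾ ⇓S , ⇓K ⟫)
  where
  carry : ∀ q → suc (8 * q + 7) ≡ 8 * suc q + 0
  carry = solve-∀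
... | no r≢7 = q , suc r , s≤s r<7 , sym (+-suc (8 * q) r) ,
      rec-suc p (⇓P₂ ⇓⨾ ⇓P₂ ⇓⨾ ⇓IFZ-suc ((⇓⟪ ⇓K , ⇓P₂ ⟫ ⇓⨾ ⇓SUB) ⇓≡ m<n⇒n∸m≡1+[n∸1+m] r<7)
                                           ⇓⟪ ⇓P₁ , ⇓P₂ ⇓⨾ ⇓S ⟫)
  where
  r<7 : r < 7
  r<7 = ≤∧≢⇒< (≤-pred r<8) r≢7

⇓DIVMOD8 : ∀ {q r} {_ : T (r <ᵇ 8)} → DIVMOD8 ∙ code q r ⇓ pair q r
⇓DIVMOD8 {q} {r} {r<8} with divmod8-trace (code q r)
... | q′ , r′ , r′<8 , eq , p with code-injective {q} {r} {q′} {r′} {r<8} {<⇒<ᵇ r′<8} eq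
... | refl , refl = ⇓⟪ ⇓K , ⇓ID ⟫ ⇓⨾ ⇓R p

-- Machine states are ⟨0,⟨e,⟨x,k⟩⟩⟩ (evaluate e at x), ⟨1,⟨v,⟨0,k⟩⟩⟩ (return v) and ⟨2,⟨v,⟨0,0⟩⟩⟩
-- (halted with v), where the stack k is ⟨frame,k′⟩. A frame ⟨t,⟨u,⟨v,w⟩⟩⟩ with tag t says what to
-- do with a returned value: 0 halt; 1 apply u; 2 evaluate u at v, then pair; 3 pair u with it;
-- 4 primitive recursion with step u, parameter v and counter w = ⟨i,n⟩; 5 μ-search of u at v,
-- currently at w.
evalState : ℕ → ℕ → ℕ → ℕ
evalState e x k = pair 0 (pair e (pair x k))

returnState : ℕ → ℕ → ℕ
returnState v k = pair 1 (pair v (pair 0 k))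

haltState : ℕ → ℕ
haltState v = pair 2 (pair v (pair 0 0))

frame : ℕ → ℕ → ℕ → ℕ → ℕ
frame t u v w = pair t (pair u (pair v w))

bottom : ℕ
bottom = pair (frame 0 0 0 0) 0

slot₁ slot₂ stack : Tm
slot₁ = P₂ ⨾ P₁
slot₂ = P₂ ⨾ P₂ ⨾ P₁
stack = P₂ ⨾ P₂ ⨾ P₂

tag field₁ field₂ field₃ stack′ : Tm
tag    = stack ⨾ P₁ ⨾ P₁
field₁ = stack ⨾ P₁ ⨾ P₂ ⨾ P₁
field₂ = stack ⨾ P₁ ⨾ P₂ ⨾ P₂ ⨾ P₁
field₃ = stack ⨾ P₁ ⨾ P₂ ⨾ P₂ ⨾ P₂
stack′ = stack ⨾ P₂

quotient remainder : Tm
quotient  = slot₁ ⨾ DIVMOD8 ⨾ P₁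
remainder = slot₁ ⨾ DIVMOD8 ⨾ P₂

mkEval : Tm → Tm → Tm → Tm
mkEval e x k = ⟪ K 0 , ⟪ e , ⟪ x , k ⟫ ⟫ ⟫

mkReturn : Tm → Tm → Tm
mkReturn v k = ⟪ K 1 , ⟪ v , ⟪ K 0 , k ⟫ ⟫ ⟫

mkFrame : ℕ → Tm → Tm → Tm → Tm
mkFrame t u v w = ⟪ K t , ⟪ u , ⟪ v , w ⟫ ⟫ ⟫

push : Tm → Tm
push fr = ⟪ fr , stack ⟫

replaceTop : Tm → Tm
replaceTop fr = ⟪ fr , stack′ ⟫

evalClauses : List⁺ Tm
evalClauses =
    mkReturn quotient stack
  ∷ mkReturn (slot₂ ⨾ S) stack
  ∷ mkReturn (slot₂ ⨾ P₁) stack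
  ∷ mkReturn (slot₂ ⨾ P₂) stack
  ∷ mkEval (quotient ⨾ P₁) slot₂ (push (mkFrame 1 (quotient ⨾ P₂) (K 0) (K 0)))
  ∷ mkEval (quotient ⨾ P₁) slot₂ (push (mkFrame 2 (quotient ⨾ P₂) slot₂ (K 0)))
  ∷ mkEval (quotient ⨾ P₁) (slot₂ ⨾ P₁)
           (push (mkFrame 4 (quotient ⨾ P₂) (slot₂ ⨾ P₁) ⟪ K 0 , slot₂ ⨾ P₂ ⟫))
  ∷ mkEval quotient ⟪ slot₂ , K 0 ⟫ (push (mkFrame 5 quotient slot₂ (K 0)))
  ∷ []

returnClauses : List⁺ Tm
returnClauses =
    ⟪ K 2 , ⟪ slot₁ , ⟪ K 0 , K 0 ⟫ ⟫ ⟫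
  ∷ mkEval field₁ slot₁ stack′
  ∷ mkEval field₁ field₂ (replaceTop (mkFrame 3 slot₁ (K 0) (K 0)))
  ∷ mkReturn ⟪ field₁ , slot₁ ⟫ stack′
  ∷ IFZ (⟪ field₃ ⨾ P₂ , field₃ ⨾ P₁ ⟫ ⨾ SUB)
        (mkReturn slot₁ stack′)
        (mkEval field₁ ⟪ field₂ , ⟪ field₃ ⨾ P₁ , slot₁ ⟫ ⟫
                (replaceTop (mkFrame 4 field₁ field₂ ⟪ field₃ ⨾ P₁ ⨾ S , field₃ ⨾ P₂ ⟫)))
  ∷ IFZ slot₁ (mkReturn field₃ stack′)
              (mkEval field₁ ⟪ field₂ , field₃ ⨾ S ⟫ (replaceTop (mkFrame 5 field₁ field₂ (field₃ ⨾ S))))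
  ∷ []

step : Tm
step = IFZ P₁ (switch remainder evalClauses) (switch tag returnClauses)

-- 2 ∸ mode, which vanishes exactly on halted states
running : Tm
running = ⟪ K 2 , P₁ ⟫ ⨾ SUB

module _ {md a b k : ℕ} where
  ⇓slot₁ : slot₁ ∙ pair md (pair a (pair b k)) ⇓ a
  ⇓slot₁ = ⇓P₂ ⇓⨾ ⇓P₁
  ⇓slot₂ : slot₂ ∙ pair md (pair a (pair b k)) ⇓ b
  ⇓slot₂ = ⇓P₂ ⇓⨾ ⇓P₂ ⇓⨾ ⇓P₁
  ⇓stack : stack ∙ pair md (pair a (pair b k)) ⇓ k
  ⇓stack = ⇓P₂ ⇓⨾ ⇓P₂ ⇓⨾ ⇓P₂

module _ {md a b t u v w k′ : ℕ} where
  private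
    st : ℕ
    st = pair md (pair a (pair b (pair (frame t u v w) k′)))
  ⇓tag : tag ∙ st ⇓ t
  ⇓tag = ⇓stack ⇓⨾ ⇓P₁ ⇓⨾ ⇓P₁
  ⇓field₁ : field₁ ∙ st ⇓ u
  ⇓field₁ = ⇓stack ⇓⨾ ⇓P₁ ⇓⨾ ⇓P₂ ⇓⨾ ⇓P₁
  ⇓field₂ : field₂ ∙ st ⇓ v
  ⇓field₂ = ⇓stack ⇓⨾ ⇓P₁ ⇓⨾ ⇓P₂ ⇓⨾ ⇓P₂ ⇓⨾ ⇓P₁
  ⇓field₃ : field₃ ∙ st ⇓ w
  ⇓field₃ = ⇓stack ⇓⨾ ⇓P₁ ⇓⨾ ⇓P₂ ⇓⨾ ⇓P₂ ⇓⨾ ⇓P₂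
  ⇓stack′ : stack′ ∙ st ⇓ k′
  ⇓stack′ = ⇓stack ⇓⨾ ⇓P₂

module _ {st : ℕ} where
  ⇓mkEval : ∀ {e x k a b c} → e ∙ st ⇓ a → x ∙ st ⇓ b → k ∙ st ⇓ c → mkEval e x k ∙ st ⇓ evalState a b c
  ⇓mkEval d₁ d₂ d₃ = ⇓⟪ ⇓K , ⇓⟪ d₁ , ⇓⟪ d₂ , d₃ ⟫ ⟫ ⟫

  ⇓mkReturn : ∀ {v k a c} → v ∙ st ⇓ a → k ∙ st ⇓ c → mkReturn v k ∙ st ⇓ returnState a c
  ⇓mkReturn d₁ d₂ = ⇓⟪ ⇓K , ⇓⟪ d₁ , ⇓⟪ ⇓K , d₂ ⟫ ⟫ ⟫

  ⇓mkFrame : ∀ {t u v w a b c} → u ∙ st ⇓ a → v ∙ st ⇓ b → w ∙ st ⇓ c →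
             mkFrame t u v w ∙ st ⇓ frame t a b c
  ⇓mkFrame d₁ d₂ d₃ = ⇓⟪ ⇓K , ⇓⟪ d₁ , ⇓⟪ d₂ , d₃ ⟫ ⟫ ⟫

module EvalStep (q r x k : ℕ) {r<8 : T (r <ᵇ 8)} where
  private
    st : ℕ
    st = evalState (code q r) x k

  ⇓quotient : quotient ∙ st ⇓ q
  ⇓quotient = ⇓slot₁ ⇓⨾ ⇓DIVMOD8 {q} {r} {r<8} ⇓⨾ ⇓P₁

  ⇓step : ∀ {y} → select evalClauses r ∙ st ⇓ y → step ∙ st ⇓ y
  ⇓step = ⇓IFZ-zero ⇓P₁ ∘ ⇓switch evalClauses (⇓slot₁ ⇓⨾ ⇓DIVMOD8 {q} {r} {r<8} ⇓⨾ ⇓P₂)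

open EvalStep

step-const : ∀ {q x k} → step ∙ evalState (code q 0) x k ⇓ returnState q k
step-const {q} {x} {k} = ⇓step q 0 x k (⇓mkReturn (⇓quotient q 0 x k) ⇓stack)

step-succ : ∀ {q x k} → step ∙ evalState (code q 1) x k ⇓ returnState (suc x) k
step-succ {q} {x} {k} = ⇓step q 1 x k (⇓mkReturn (⇓slot₂ ⇓⨾ ⇓S) ⇓stack)

step-fst : ∀ {q a b k} → step ∙ evalState (code q 2) (pair a b) k ⇓ returnState a k
step-fst {q} {a} {b} {k} = ⇓step q 2 (pair a b) k (⇓mkReturn (⇓slot₂ ⇓⨾ ⇓P₁) ⇓stack)

step-snd : ∀ {q a b k} → step ∙ evalState (code q 3) (pair a b) k ⇓ returnState b k
step-snd {q} {a} {b} {k} = ⇓step q 3 (pair a b) k (⇓mkReturn (⇓slot₂ ⇓⨾ ⇓P₂) ⇓stack)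

step-comp : ∀ {f g x k} →
  step ∙ evalState (code (pair f g) 4) x k ⇓ evalState f x (pair (frame 1 g 0 0) k)
step-comp {f} {g} {x} {k} = ⇓step (pair f g) 4 x k
  (⇓mkEval (q ⇓⨾ ⇓P₁) ⇓slot₂ ⇓⟪ ⇓mkFrame (q ⇓⨾ ⇓P₂) ⇓K ⇓K , ⇓stack ⟫)
  where q = ⇓quotient (pair f g) 4 x k

step-pair : ∀ {f g x k} →
  step ∙ evalState (code (pair f g) 5) x k ⇓ evalState f x (pair (frame 2 g x 0) k)
step-pair {f} {g} {x} {k} = ⇓step (pair f g) 5 x k
  (⇓mkEval (q ⇓⨾ ⇓P₁) ⇓slot₂ ⇓⟪ ⇓mkFrame (q ⇓⨾ ⇓P₂) ⇓slot₂ ⇓K , ⇓stack ⟫)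
  where q = ⇓quotient (pair f g) 5 x k

step-prec : ∀ {f g a n k} →
  step ∙ evalState (code (pair f g) 6) (pair a n) k ⇓ evalState f a (pair (frame 4 g a (pair 0 n)) k)
step-prec {f} {g} {a} {n} {k} = ⇓step (pair f g) 6 (pair a n) k
  (⇓mkEval (q ⇓⨾ ⇓P₁) (⇓slot₂ ⇓⨾ ⇓P₁)
           ⇓⟪ ⇓mkFrame (q ⇓⨾ ⇓P₂) (⇓slot₂ ⇓⨾ ⇓P₁) ⇓⟪ ⇓K , ⇓slot₂ ⇓⨾ ⇓P₂ ⟫ , ⇓stack ⟫)
  where q = ⇓quotient (pair f g) 6 (pair a n) k

step-mu : ∀ {f x k} → step ∙ evalState (code f 7) x k ⇓ evalState f (pair x 0) (pair (frame 5 f x 0) k)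
step-mu {f} {x} {k} = ⇓step f 7 x k (⇓mkEval q ⇓⟪ ⇓slot₂ , ⇓K ⟫ ⇓⟪ ⇓mkFrame q ⇓slot₂ ⇓K , ⇓stack ⟫)
  where q = ⇓quotient f 7 x k

⇓step-return : ∀ {v t u w₁ w₂ k′ y} →
  select returnClauses t ∙ returnState v (pair (frame t u w₁ w₂) k′) ⇓ y →
  step ∙ returnState v (pair (frame t u w₁ w₂) k′) ⇓ y
⇓step-return = ⇓IFZ-suc ⇓P₁ ∘ ⇓switch returnClauses ⇓tag

step-halt : ∀ {v u w₁ w₂ k′} → step ∙ returnState v (pair (frame 0 u w₁ w₂) k′) ⇓ haltState v
step-halt = ⇓step-return ⇓⟪ ⇓K , ⇓⟪ ⇓slot₁ , ⇓⟪ ⇓K , ⇓K ⟫ ⟫ ⟫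

step-return-comp : ∀ {v g w₁ w₂ k′} → step ∙ returnState v (pair (frame 1 g w₁ w₂) k′) ⇓ evalState g v k′
step-return-comp = ⇓step-return (⇓mkEval ⇓field₁ ⇓slot₁ ⇓stack′)

step-return-pair₁ : ∀ {y g x w k′} →
  step ∙ returnState y (pair (frame 2 g x w) k′) ⇓ evalState g x (pair (frame 3 y 0 0) k′)
step-return-pair₁ = ⇓step-return (⇓mkEval ⇓field₁ ⇓field₂ ⇓⟪ ⇓mkFrame ⇓slot₁ ⇓K ⇓K , ⇓stack′ ⟫)

step-return-pair₂ : ∀ {z y w₁ w₂ k′} →
  step ∙ returnState z (pair (frame 3 y w₁ w₂) k′) ⇓ returnState (pair y z) k′
step-return-pair₂ = ⇓step-return (⇓mkReturn ⇓⟪ ⇓field₁ , ⇓slot₁ ⟫ ⇓stack′)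

step-return-prec-done : ∀ {v g a n k′} →
  step ∙ returnState v (pair (frame 4 g a (pair n n)) k′) ⇓ returnState v k′
step-return-prec-done {n = n} = ⇓step-return
  (⇓IFZ-zero ((⇓⟪ ⇓field₃ ⇓⨾ ⇓P₂ , ⇓field₃ ⇓⨾ ⇓P₁ ⟫ ⇓⨾ ⇓SUB) ⇓≡ n∸n≡0 n)
             (⇓mkReturn ⇓slot₁ ⇓stack′))

step-return-prec-next : ∀ {v g a i n k′} → i < n →
  step ∙ returnState v (pair (frame 4 g a (pair i n)) k′)
     ⇓ evalState g (pair a (pair i v)) (pair (frame 4 g a (pair (suc i) n)) k′)
step-return-prec-next i<n = ⇓step-return
  (⇓IFZ-suc ((⇓⟪ ⇓field₃ ⇓⨾ ⇓P₂ , ⇓field₃ ⇓⨾ ⇓P₁ ⟫ ⇓⨾ ⇓SUB) ⇓≡ m<n⇒n∸m≡1+[n∸1+m] i<n)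
            (⇓mkEval ⇓field₁ ⇓⟪ ⇓field₂ , ⇓⟪ ⇓field₃ ⇓⨾ ⇓P₁ , ⇓slot₁ ⟫ ⟫
                     ⇓⟪ ⇓mkFrame ⇓field₁ ⇓field₂ ⇓⟪ ⇓field₃ ⇓⨾ ⇓P₁ ⇓⨾ ⇓S , ⇓field₃ ⇓⨾ ⇓P₂ ⟫ , ⇓stack′ ⟫))

step-return-mu-found : ∀ {f x j k′} → step ∙ returnState 0 (pair (frame 5 f x j) k′) ⇓ returnState j k′
step-return-mu-found = ⇓step-return (⇓IFZ-zero ⇓slot₁ (⇓mkReturn ⇓field₃ ⇓stack′))

step-return-mu-next : ∀ {m f x j k′} →
  step ∙ returnState (suc m) (pair (frame 5 f x j) k′)
     ⇓ evalState f (pair x (suc j)) (pair (frame 5 f x (suc j)) k′)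
step-return-mu-next = ⇓step-return
  (⇓IFZ-suc ⇓slot₁ (⇓mkEval ⇓field₁ ⇓⟪ ⇓field₂ , ⇓field₃ ⇓⨾ ⇓S ⟫
                            ⇓⟪ ⇓mkFrame ⇓field₁ ⇓field₂ (⇓field₃ ⇓⨾ ⇓S) , ⇓stack′ ⟫))

data Run : ℕ → ℕ → Set where
  done : ∀ {s} → Run s s
  more : ∀ {s s′ s″ m} → running ∙ s ⇓ suc m → step ∙ s ⇓ s′ → Run s′ s″ → Run s s″

infixr 5 _++ᴿ_
_++ᴿ_ : ∀ {s s′ s″} → Run s s′ → Run s′ s″ → Run s s″
done          ++ᴿ r′ = r′
more h st r   ++ᴿ r′ = more h st (r ++ᴿ r′)

running-eval : ∀ {e x k} → running ∙ evalState e x k ⇓ 2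
running-eval = ⇓⟪ ⇓K , ⇓P₁ ⟫ ⇓⨾ ⇓SUB

running-return : ∀ {v k} → running ∙ returnState v k ⇓ 1
running-return = ⇓⟪ ⇓K , ⇓P₁ ⟫ ⇓⨾ ⇓SUB

running-halt : ∀ {v} → running ∙ haltState v ⇓ 0
running-halt = ⇓⟪ ⇓K , ⇓P₁ ⟫ ⇓⨾ ⇓SUB

eval-then : ∀ {e x k s′ s″} → step ∙ evalState e x k ⇓ s′ → Run s′ s″ → Run (evalState e x k) s″
eval-then = more running-eval

return-then : ∀ {v k s′ s″} → step ∙ returnState v k ⇓ s′ → Run s′ s″ → Run (returnState v k) s″
return-then = more running-return

Eval⇒Run : ∀ {e x y} → Eval e x y → ∀ k → Run (evalState e x k) (returnState y k)
PR⇒Run : ∀ {f g a j y n} → PR f g a j y → j ≤ n → ∀ k →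
  Run (evalState f a (pair (frame 4 g a (pair 0 n)) k)) (returnState y (pair (frame 4 g a (pair j n)) k))
Mu⇒Run : ∀ {f x j n} → Mu f x j n → ∀ k →
  Run (evalState f (pair x j) (pair (frame 5 f x j) k)) (returnState n k)

Eval⇒Run (ev-const {q}) k = eval-then (step-const {q}) done
Eval⇒Run (ev-succ {q}) k = eval-then (step-succ {q}) done
Eval⇒Run (ev-fst {q} {a} {b}) k =
  subst (λ v → Run (evalState (code q 2) v k) (returnState a k)) (pair-unfold a b)
        (eval-then (step-fst {q}) done)
Eval⇒Run (ev-snd {q} {a} {b}) k =
  subst (λ v → Run (evalState (code q 3) v k) (returnState b k)) (pair-unfold a b)
        (eval-then (step-snd {q}) done)
Eval⇒Run (ev-comp {f} {g} {x} {_} {z} d₁ d₂) k =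
  subst (λ v → Run (evalState (code v 4) x k) (returnState z k)) (pair-unfold f g)
        (eval-then step-comp (Eval⇒Run d₁ _ ++ᴿ return-then step-return-comp (Eval⇒Run d₂ k)))
Eval⇒Run (ev-pair {f} {g} {x} {y} {z} d₁ d₂) k =
  subst₂ (λ v w → Run (evalState (code v 5) x k) (returnState w k)) (pair-unfold f g) (pair-unfold y z)
         (eval-then step-pair (Eval⇒Run d₁ _ ++ᴿ return-then step-return-pair₁
                                (Eval⇒Run d₂ _ ++ᴿ return-then step-return-pair₂ done)))
Eval⇒Run (ev-prec {f} {g} {a} {n} {y} p) k =
  subst₂ (λ v w → Run (evalState (code v 6) w k) (returnState y k)) (pair-unfold f g) (pair-unfold a n)
         (eval-then step-prec (PR⇒Run p ≤-refl k ++ᴿ return-then step-return-prec-done done))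
Eval⇒Run (ev-mu {f} μ) k = eval-then (step-mu {f}) (Mu⇒Run μ k)

PR⇒Run (pr-zero d) _ k = Eval⇒Run d _
PR⇒Run {g = g} {a} {suc j} {w} (pr-suc {y = y} p d) 1+j≤n k =
  PR⇒Run p (≤-trans (n≤1+n j) 1+j≤n) k ++ᴿ return-then (step-return-prec-next 1+j≤n)
    (subst (λ v → Run (evalState g v _) (returnState w _)) (sym unfold) (Eval⇒Run d _))
  where
  unfold : pair a (pair j y) ≡ ⟨ a , ⟨ j , y ⟩ ⟩
  unfold = trans (pair-unfold a (pair j y)) (cong ⟨ a ,_⟩ (pair-unfold j y))

Mu⇒Run {f} {x} {j} (mu-stop d) k =
  subst (λ v → Run (evalState f v k′) (returnState 0 k′)) (sym (pair-unfold x j)) (Eval⇒Run d k′)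
    ++ᴿ return-then step-return-mu-found done
  where
  k′ : ℕ
  k′ = pair (frame 5 f x j) k
Mu⇒Run {f} {x} {j} (mu-next {m = m} d μ) k =
  subst (λ v → Run (evalState f v k′) (returnState (suc m) k′)) (sym (pair-unfold x j)) (Eval⇒Run d k′)
    ++ᴿ return-then step-return-mu-next (Mu⇒Run μ k)
  where
  k′ : ℕ
  k′ = pair (frame 5 f x j) k

infixr 5 _▹_ _&_
_▹_ _&_ : ℕ → ℕ → ℕ
f ▹ g = code ⟨ f , g ⟩ 4
f & g = code ⟨ f , g ⟩ 5

initial advance : Tm
initial = mkEval P₁ P₂ (K bottom)
advance = P₂ ⨾ P₂ ⨾ step

Iterate : ℕ → ℕ → ℕ → Set
Iterate = Rec initial advance

iterate : Tm
iterate = R initial advance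

-- ⟨e,x⟩ ↦ slot₁ of the state at the first n at which the run from evalState e x bottom halts
universal : ℕ
universal = (compile ID & code (compile (iterate ⨾ running)) 7) ▹ compile (iterate ⨾ slot₁)

⇓⇒Eval : ∀ {t a b y} → t ∙ pair a b ⇓ y → Eval (compile t) ⟨ a , b ⟩ y
⇓⇒Eval {t} {a} {b} {y} d = subst (λ v → Eval (compile t) v y) (pair-unfold a b) (run d)

halting-search : ∀ {z j s h} → Iterate z j s → Run s h → running ∙ h ⇓ 0 →
                 Σ ℕ λ n → Mu (compile (iterate ⨾ running)) z j n × Iterate z n h
halting-search {z} {j} it done halted =
  j , mu-stop {compile (iterate ⨾ running)} {z} {j}
                (⇓⇒Eval {iterate ⨾ running} (⇓R it ⇓⨾ halted)) , it
halting-search {z} {j} it (more running-s st r) halted =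
  let n , μ , it′ = halting-search (rec-suc it (⇓P₂ ⇓⨾ ⇓P₂ ⇓⨾ st)) r halted
  in n , mu-next {compile (iterate ⨾ running)} {z} {j}
                 (⇓⇒Eval {iterate ⨾ running} (⇓R it ⇓⨾ running-s)) μ , it′

universal-eval : ∀ {e x y} → Eval e x y → Eval universal ⟨ e , x ⟩ y
universal-eval {e} {x} {y} d = subst (λ z → Eval universal z y) (pair-unfold e x) on-pair
  where
  on-pair : Eval universal (pair e x) y
  on-pair =
    let n , μ , it = halting-search (rec-zero (⇓mkEval ⇓P₁ ⇓P₂ ⇓K))
                       (Eval⇒Run d bottom ++ᴿ return-then step-halt done) running-halt
    in ev-comp {compile ID & code (compile (iterate ⨾ running)) 7} {compile (iterate ⨾ slot₁)}
               {pair e x} {⟨ pair e x , n ⟩} {y}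
         (ev-pair {compile ID} {code (compile (iterate ⨾ running)) 7} {pair e x} {pair e x} {n}
                  (run ⇓ID) (ev-mu {compile (iterate ⨾ running)} {pair e x} {n} μ))
         (⇓⇒Eval {iterate ⨾ slot₁} (⇓R it ⇓⨾ ⇓slot₁))

▹-realizes : ∀ {A p q : Pred 0ℓ} {r a} → (A ⇒ p) r → (p ⇒ q) a → (A ⇒ q) (r ▹ a)
▹-realizes r-realizes a-realizes x x∈A with r-realizes x x∈A
... | y , ev₁ , y∈p with a-realizes y y∈p
... | z , ev₂ , z∈q = z , ev-comp ev₁ ev₂ , z∈q

⇒-antitone : ∀ {A B q : Pred 0ℓ} {e} → (∀ {x} → A x → B x) → (B ⇒ q) e → (A ⇒ q) e
⇒-antitone A⊆B e-realizes x x∈A = e-realizes x (A⊆B x∈A)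

times8 : Tm
times8 = double ⨾ double ⨾ double
  where
  double : Tm
  double = ⟪ ID , ID ⟫ ⨾ ADD

⇓times8 : ∀ {n} → times8 ∙ n ⇓ 8 * n
⇓times8 {n} = (double ⇓⨾ double ⇓⨾ double) ⇓≡ eightfold n
  where
  double : ∀ {m} → ⟪ ID , ID ⟫ ⨾ ADD ∙ m ⇓ m + m
  double = ⇓⟪ ⇓ID , ⇓ID ⟫ ⇓⨾ ⇓ADD
  eightfold : ∀ n → (n + n + (n + n)) + (n + n + (n + n)) ≡ 8 * n
  eightfold = solve-∀

codeᵀ : ℕ → Tm → Tm
codeᵀ r t = t ⨾ times8 ⨾ ⟪ ID , K r ⟫ ⨾ ADD

⇓codeᵀ : ∀ {r t x v} → t ∙ x ⇓ v → codeᵀ r t ∙ x ⇓ code v r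
⇓codeᵀ d = d ⇓⨾ ⇓times8 ⇓⨾ ⇓⟪ ⇓ID , ⇓K ⟫ ⇓⨾ ⇓ADD

infixr 5 _▹ᵀ_ _&ᵀ_
_▹ᵀ_ _&ᵀ_ : Tm → Tm → Tm
t ▹ᵀ u = codeᵀ 4 ⟪ t , u ⟫
t &ᵀ u = codeᵀ 5 ⟪ t , u ⟫

⇓▹ᵀ : ∀ {t u x f g} → t ∙ x ⇓ f → u ∙ x ⇓ g → t ▹ᵀ u ∙ x ⇓ f ▹ g
⇓▹ᵀ {f = f} {g} d₁ d₂ = ⇓codeᵀ ⇓⟪ d₁ , d₂ ⟫ ⇓≡ cong (λ v → code v 4) (pair-unfold f g)

⇓&ᵀ : ∀ {t u x f g} → t ∙ x ⇓ f → u ∙ x ⇓ g → t &ᵀ u ∙ x ⇓ f & g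
⇓&ᵀ {f = f} {g} d₁ d₂ = ⇓codeᵀ ⇓⟪ d₁ , d₂ ⟫ ⇓≡ cong (λ v → code v 5) (pair-unfold f g)

compose-codes : Tm
compose-codes = codeᵀ 4 ID

-- ⟨a,b⟩ ↦ b (r ▹ a)
lift-code : ℕ → ℕ
lift-code r = (code 0 3 & ((code r 0 & code 0 2) ▹ compile compose-codes)) ▹ universal

lift-code-eval : ∀ {r a b y} → Eval b (r ▹ a) y → Eval (lift-code r) ⟨ a , b ⟩ y
lift-code-eval {r} {a} {b} d =
  ev-comp (ev-pair (ev-snd {0} {a} {b})
                   (ev-comp (ev-pair (ev-const {r}) (ev-fst {0} {a} {b})) (run (⇓codeᵀ ⇓ID))))
          (universal-eval d)

lifter : Tm
lifter = (K (code 0 3) &ᵀ ((codeᵀ 0 ID &ᵀ K (code 0 2)) ▹ᵀ K (compile compose-codes))) ▹ᵀ K universal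

⇓lifter : ∀ {r} → lifter ∙ r ⇓ lift-code r
⇓lifter = ⇓▹ᵀ (⇓&ᵀ ⇓K (⇓▹ᵀ (⇓&ᵀ (⇓codeᵀ ⇓ID) ⇓K) ⇓K)) ⇓K

▹-G-Oω1⇒G-Ofin : ∀ {α m p q r a} → 1 ≤ m → m ≤ α →
                  G Oω1 p r → (p ⇒ q) a → G (Ofin α m) q (r ▹ a)
▹-G-Oω1⇒G-Ofin 1≤m m≤α (k , r-realizes) a-realizes
  with subset-of-co-size-missing k 1≤m m≤α
... | X , c , k∉X = (X , c) , ▹-realizes (⇒-antitone X⊆ℕ∖k r-realizes) a-realizes
  where
  X⊆ℕ∖k : ∀ {x} → embed X x → x ≢ k
  X⊆ℕ∖k x∈X refl = k∉X x∈X

G-Oω1-≤L-G-Ofin : ∀ {α m} → 1 ≤ m → m ≤ α → G Oω1 ≤L G (Ofin α m)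
G-Oω1-≤L-G-Ofin {α} {m} 1≤m m≤α =
  compile lifter , λ p r r∈G → lift-code r , run ⇓lifter , lifted p r r∈G
  where
  lifted : ∀ p r → G Oω1 p r → L (G (Ofin α m)) p (lift-code r)
  lifted p r r∈G q _ (a , b , refl , a-realizes , b-realizes) =
    let y , ev , y∈q = b-realizes (r ▹ a) (▹-G-Oω1⇒G-Ofin 1≤m m≤α r∈G a-realizes)
    in y , lift-code-eval {r} {a} {b} ev , y∈q

proposition5p7 : (m α : ℕ) → 1 ≤ m → 1 < 2 * m → 2 * m < α →
    ¬ (G (Ofin α m) ≤L G Oω1) × (G Oω1 <L G (Ofin α m))
proposition5p7 m α 1≤m _ 2m<α = Ofin≰Oω1 , G-Oω1-≤L-G-Ofin 1≤m m≤α , Ofin≰Oω1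
  where
  m≤α : m ≤ α
  m≤α = ≤-trans (m≤m+n m (m + 0)) (<⇒≤ 2m<α)
  Ofin≰Oω1 : ¬ (G (Ofin α m) ≤L G Oω1)
  Ofin≰Oω1 = G-Ofin-≰L-G-Oω1 1≤m m≤α
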